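{- Let $f:\mathbb{N}\to\mathbb{N}$ satisfy $f(n)\to\infty$ as $n\to\infty$, and fix an integer $d\ge 0$. If the sequence $\{ M_{f,k}(d) \}_{k=2}^{\infty}$ is bounded, then \[ \lim_{k\to \infty} M_{f,k}(d) = L_f(d). \]
   Context: $\mathbb{N}=\{1,2,3,\dots\}$. For integers $k\ge 2$, $n\ge1$: $\Delta_{f,k}(n) := \min\{|f(n) - m^k| : m \in \mathbb{Z}\}$. For $d\ge0$: $M_{f,k}(d) := \max\{n \in \mathbb{N} : \Delta_{f,k}(n) \le d\}$ if this maximum exists, and $\infty$ otherwise; $L_f(d) := \max\{n \in\mathbb{N}: f(n) \le d+1\}$ if this maximum exists, and $\infty$ otherwise. -}

module Defs where

open import Data.Nat using (ℕ; _≤_; _+_)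
open import Data.Integer as ℤ using (ℤ; +_; ∣_∣)
open import Data.Product using (Σ; _×_; ∃)

-- Δ_{f,k}(n) ≤ d  :  the minimum over m ∈ ℤ of |f(n) - m^k| is at most d,
-- i.e. some integer m has |f(n) - m^k| ≤ d.
ΔLe : (f : ℕ → ℕ) (k n d : ℕ) → Set
ΔLe f k n d = Σ ℤ λ m → ∣ (+ f n) ℤ.- (m ℤ.^ k) ∣ ≤ d

IsMaxℕ⁺ : (ℕ → Set) → ℕ → Set
IsMaxℕ⁺ P n = (1 ≤ n × P n) × (∀ m → 1 ≤ m → P m → m ≤ n)

-- "M_{f,k}(d) = n" (finite value n): n = max{ n ∈ ℕ : Δ_{f,k}(n) ≤ d }
MIs : (f : ℕ → ℕ) (k d n : ℕ) → Set
MIs f k d n = IsMaxℕ⁺ (λ m → ΔLe f k m d) n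

-- "L_f(d) = n" (finite value n): n = max{ n ∈ ℕ : f(n) ≤ d+1 }
LIs : (f : ℕ → ℕ) (d n : ℕ) → Set
LIs f d n = IsMaxℕ⁺ (λ m → f m ≤ d + 1) n

TendsToInfinity : (ℕ → ℕ) → Set
TendsToInfinity f = ∀ B → ∃ λ N → ∀ n → N ≤ n → B ≤ f n

{-# OPTIONS --safe #-}
-- For k > f(n) + d the only k-th powers within d of f(n) are 0 and ±1, because
-- |m| ≥ 2 gives |m|^k > k; hence Δ_{f,k}(n) ≤ d forces f(n) ≤ d + 1, and conversely
-- f(n) ≤ d + 1 gives Δ_{f,k}(n) ≤ d for every k via m = 1, since f(n) ≥ 1.  So the
-- L_f(d)-set lies in every M_{f,k}(d)-set.  Once k exceeds max_{n ≤ B} f(n) + d,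
-- where B bounds all M_{f,k}(d), the maximum M_{f,k}(d) itself lies in the smaller
-- L_f(d)-set and is therefore its maximum.
module Submission where

open import Defs
open import Data.Nat using (ℕ; zero; suc; _+_; _∸_; _*_; _^_; _≤_; _<_; _⊔_; z≤n; s≤s; _≤?_)
open import Data.Nat.Properties
open import Data.Integer as ℤ using (ℤ; +_; ∣_∣; 1ℤ)
import Data.Integer.Properties as ℤ
open import Data.Product using (_×_; ∃; _,_)
open import Data.Sum using (inj₁; inj₂)
open import Relation.Nullary using (yes; no; contradiction)
open import Relation.Binary.PropositionalEquality using (_≡_; refl; cong; subst; module ≡-Reasoning)

n<m^n : ∀ {m} → 1 < m → ∀ n → n < m ^ n
n<m^n 1<m zero    = s≤s z≤n
n<m^n {m} 1<m (suc n) = begin-strict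
  suc n           <⟨ n<1+n (suc n) ⟩
  2 + n           ≤⟨ +-monoʳ-≤ 2 (m≤n*m n 2) ⟩
  2 + 2 * n       ≡⟨ *-suc 2 n ⟨
  2 * suc n       ≤⟨ *-mono-≤ 1<m (n<m^n 1<m n) ⟩
  m * m ^ n       ∎
  where open ≤-Reasoning

∣i∣≤∣i-j∣+∣j∣ : ∀ i j → ∣ i ∣ ≤ ∣ i ℤ.- j ∣ + ∣ j ∣
∣i∣≤∣i-j∣+∣j∣ i j = subst (λ x → ∣ x ∣ ≤ ∣ i ℤ.- j ∣ + ∣ j ∣) [i-j]+j≡i (ℤ.∣i+j∣≤∣i∣+∣j∣ (i ℤ.- j) j)
  where
  open ≡-Reasoning
  [i-j]+j≡i : (i ℤ.- j) ℤ.+ j ≡ i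
  [i-j]+j≡i = begin
    (i ℤ.- j) ℤ.+ j      ≡⟨ ℤ.+-assoc i (ℤ.- j) j ⟩
    i ℤ.+ (ℤ.- j ℤ.+ j)  ≡⟨ cong (λ y → i ℤ.+ y) (ℤ.+-inverseˡ j) ⟩
    i ℤ.+ ℤ.0ℤ           ≡⟨ ℤ.+-identityʳ i ⟩
    i                    ∎

∣i^n∣≡∣i∣^n : ∀ i n → ∣ i ℤ.^ n ∣ ≡ ∣ i ∣ ^ n
∣i^n∣≡∣i∣^n i zero    = refl
∣i^n∣≡∣i∣^n i (suc n) = begin
  ∣ i ℤ.* i ℤ.^ n ∣     ≡⟨ ℤ.∣i*j∣≡∣i∣*∣j∣ i (i ℤ.^ n) ⟩
  ∣ i ∣ * ∣ i ℤ.^ n ∣   ≡⟨ cong (∣ i ∣ *_) (∣i^n∣≡∣i∣^n i n) ⟩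
  ∣ i ∣ * ∣ i ∣ ^ n     ∎
  where open ≡-Reasoning

near-kth-power⇒≤d+1 : ∀ {a d k} (x : ℤ) → a + d < k → ∣ + a ℤ.- x ℤ.^ k ∣ ≤ d → a ≤ d + 1
near-kth-power⇒≤d+1 {a} {d} {k} x a+d<k near with ∣ x ∣ ≤? 1
... | yes ∣x∣≤1 = begin
  a                                 ≤⟨ ∣i∣≤∣i-j∣+∣j∣ (+ a) (x ℤ.^ k) ⟩
  ∣ + a ℤ.- x ℤ.^ k ∣ + ∣ x ℤ.^ k ∣   ≤⟨ +-mono-≤ near ∣x^k∣≤1 ⟩
  d + 1                             ∎
  where
  open ≤-Reasoning
  ∣x^k∣≤1 : ∣ x ℤ.^ k ∣ ≤ 1
  ∣x^k∣≤1 = begin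
    ∣ x ℤ.^ k ∣  ≡⟨ ∣i^n∣≡∣i∣^n x k ⟩
    ∣ x ∣ ^ k    ≤⟨ ^-monoˡ-≤ k ∣x∣≤1 ⟩
    1 ^ k        ≡⟨ ^-zeroˡ k ⟩
    1            ∎
... | no ∣x∣≰1 = contradiction (begin-strict
  k                               <⟨ n<m^n (≰⇒> ∣x∣≰1) k ⟩
  ∣ x ∣ ^ k                       ≡⟨ ∣i^n∣≡∣i∣^n x k ⟨
  ∣ x ℤ.^ k ∣                     ≤⟨ ∣i∣≤∣i-j∣+∣j∣ (x ℤ.^ k) (+ a) ⟩
  ∣ x ℤ.^ k ℤ.- + a ∣ + a         ≡⟨ cong (_+ a) (ℤ.∣i-j∣≡∣j-i∣ (x ℤ.^ k) (+ a)) ⟩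
  ∣ + a ℤ.- x ℤ.^ k ∣ + a         ≤⟨ +-monoˡ-≤ a near ⟩
  d + a                           ≡⟨ +-comm d a ⟩
  a + d                           ∎) (<-asym a+d<k)
  where open ≤-Reasoning

bounded-on-prefix : (f : ℕ → ℕ) (B : ℕ) → ∃ λ S → ∀ {n} → n ≤ B → f n ≤ S
bounded-on-prefix f zero = f 0 , λ { z≤n → ≤-refl }
bounded-on-prefix f (suc B) with bounded-on-prefix f B
... | S , f≤S = S ⊔ f (suc B) , bound
  where
  bound : ∀ {n} → n ≤ suc B → f n ≤ S ⊔ f (suc B)
  bound n≤1+B with m≤n⇒m<n∨m≡n n≤1+B
  ... | inj₁ n<1+B = ≤-trans (f≤S (≤-pred n<1+B)) (m≤m⊔n S (f (suc B)))
  ... | inj₂ refl  = m≤n⊔m S (f (suc B))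

IsMaxℕ⁺-unique : ∀ {P : ℕ → Set} {m n} → IsMaxℕ⁺ P m → IsMaxℕ⁺ P n → m ≡ n
IsMaxℕ⁺-unique ((1≤m , Pm) , m-max) ((1≤n , Pn) , n-max) =
  ≤-antisym (n-max _ 1≤m Pm) (m-max _ 1≤n Pn)

IsMaxℕ⁺-⊆ : ∀ {P Q : ℕ → Set} {n} → (∀ m → 1 ≤ m → Q m → P m) →
  IsMaxℕ⁺ P n → Q n → IsMaxℕ⁺ Q n
IsMaxℕ⁺-⊆ Q⊆P ((1≤n , _) , n-max) Qn =
  (1≤n , Qn) , λ m 1≤m Qm → n-max m 1≤m (Q⊆P m 1≤m Qm)

ΔLe-one : ∀ {f k n d} → 1 ≤ f n → f n ≤ d + 1 → ΔLe f k n d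
ΔLe-one {f} {k} {n} {d} 1≤fn fn≤d+1 = 1ℤ , (begin
  ∣ + f n ℤ.- 1ℤ ℤ.^ k ∣  ≡⟨ cong (λ y → ∣ + f n ℤ.- y ∣) (ℤ.^-zeroˡ k) ⟩
  ∣ + f n ℤ.- 1ℤ ∣        ≡⟨ cong ∣_∣ (ℤ.m-n≡m⊖n (f n) 1) ⟩
  ∣ f n ℤ.⊖ 1 ∣           ≡⟨ cong ∣_∣ (ℤ.⊖-≥ 1≤fn) ⟩
  f n ∸ 1                ≤⟨ ∸-monoˡ-≤ 1 fn≤d+1 ⟩
  d + 1 ∸ 1              ≡⟨ m+n∸n≡m d 1 ⟩
  d                      ∎)
  where open ≤-Reasoning

MIs⇒LIs : ∀ {f k d M} → (∀ n → 1 ≤ n → 1 ≤ f n) → f M + d < k → MIs f k d M → LIs f d M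
MIs⇒LIs {f} {k} {d} f⁺ fM+d<k M-max@((_ , x , near) , _) =
  IsMaxℕ⁺-⊆ (λ m 1≤m fm≤d+1 → ΔLe-one {f} {k} {m} (f⁺ m 1≤m) fm≤d+1) M-max
    (near-kth-power⇒≤d+1 x fM+d<k near)

MIs⇒LIs-eventually : ∀ {f d} → (∀ n → 1 ≤ n → 1 ≤ f n) →
  (∃ λ B → ∀ k → 2 ≤ k → ∃ λ M → MIs f k d M × M ≤ B) →
  ∃ λ K → ∀ k → K ≤ k → 2 ≤ k → ∃ λ M → MIs f k d M × LIs f d M
MIs⇒LIs-eventually {f} {d} f⁺ (B , M-bounded) with bounded-on-prefix f B
... | S , f≤S = suc (S + d) , λ k 1+S+d≤k 2≤k →
  let M , M-max , M≤B = M-bounded k 2≤k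
  in M , M-max , MIs⇒LIs f⁺ (<-≤-trans (s≤s (+-monoˡ-≤ d (f≤S M≤B))) 1+S+d≤k) M-max

-- The hypothesis f → ∞ is unused: boundedness of the M_{f,k}(d) alone forces
-- M_{f,k}(d) = L_f(d) for all large k.
proposition2p2 : (f : ℕ → ℕ) → (∀ n → 1 ≤ n → 1 ≤ f n) → TendsToInfinity f → (d : ℕ) →
    (∃ λ B → ∀ k → 2 ≤ k → ∃ λ M → MIs f k d M × M ≤ B) →
    ∃ λ L → LIs f d L × (∃ λ K → ∀ k → K ≤ k → 2 ≤ k → MIs f k d L)
proposition2p2 f f⁺ _ d M-bounded with MIs⇒LIs-eventually f⁺ M-bounded
... | K , M-is-L with M-is-L (K + 2) (m≤m+n K 2) (m≤n+m 2 K)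
...   | L , _ , L-max = L , L-max , K , L-is-M
  where
  L-is-M : ∀ k → K ≤ k → 2 ≤ k → MIs f k d L
  L-is-M k K≤k 2≤k =
    let M , M-max , M-Lmax = M-is-L k K≤k 2≤k
    in subst (MIs f k d) (IsMaxℕ⁺-unique M-Lmax L-max) M-max
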